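{- Let $H$ be a maximal graph in $\mathcal F_n(2)$, with vertex set $W$. Then there is a partition $W=W_0\cup W_1\cup\cdots\cup W_6$ with $|W_0|=4\epsilon n$, $|W_6|=2\epsilon n$ and $|W_i|\geq 2\epsilon n$ for $i=1,\dots,5$, such that: (1) $W_1,\dots,W_5$ are each $2$-independent in $H$; (2) $W_6$ is $3$-independent in $H$ and every vertex of $W_6$ has degree $2$ in $H$; (3) $W_0=N_H(W_6)$.
   Context: $\epsilon=0.001$; rounding of $\epsilon n$ etc. to integers is ignored. $\mathcal F_n(2)$ is the family of graphs on $n$ vertices with maximum degree at most $2$; $H\in\mathcal F_n(2)$ is maximal if no edge can be added to $H$ while keeping it in $\mathcal F_n(2)$. A vertex subset is $k$-independent in $H$ if every two distinct vertices of it are at distance greater than $k$ in $H$. $N_H(S)$ denotes the set of vertices adjacent in $H$ to some vertex of $S$. -}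

module Defs where

open import Data.Nat using (ℕ; zero; suc; _≤_; _*_)
open import Data.Bool using (Bool; true; false; _∨_; _∧_)
open import Data.Fin using (Fin)
open import Data.Fin.Properties using (_≟_)
open import Data.Fin.Subset using (Subset; ∣_∣)
open import Data.Vec using (tabulate)
open import Data.Product using (Σ; ∃; _×_)
open import Relation.Nullary using (¬_; ⌊_⌋)
open import Relation.Binary.PropositionalEquality using (_≡_; _≢_)

record Graph (n : ℕ) : Set where
  field
    adj    : Fin n → Fin n → Bool
    sym    : ∀ u v → adj u v ≡ adj v u
    irrefl : ∀ v → adj v v ≡ false
open Graph public

deg : {n : ℕ} → (Fin n → Fin n → Bool) → Fin n → ℕ
deg a v = ∣ tabulate (a v) ∣

MaxDeg2 : {n : ℕ} → (Fin n → Fin n → Bool) → Set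
MaxDeg2 a = ∀ v → deg a v ≤ 2

InF2 : {n : ℕ} → Graph n → Set
InF2 G = MaxDeg2 (adj G)

addEdge : {n : ℕ} → (Fin n → Fin n → Bool) → Fin n → Fin n → Fin n → Fin n → Bool
addEdge a u v x y =
  a x y ∨ ((⌊ x ≟ u ⌋ ∧ ⌊ y ≟ v ⌋) ∨ (⌊ x ≟ v ⌋ ∧ ⌊ y ≟ u ⌋))

MaximalF2 : {n : ℕ} → Graph n → Set
MaximalF2 G =
  InF2 G × (∀ u v → u ≢ v → adj G u v ≡ false → ¬ MaxDeg2 (addEdge (adj G) u v))

data Walk {n : ℕ} (G : Graph n) : ℕ → Fin n → Fin n → Set where
  here : ∀ {x} → Walk G 0 x x
  step : ∀ {l x y z} → adj G x y ≡ true → Walk G l y z → Walk G (suc l) x z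

DistGt : {n : ℕ} → Graph n → ℕ → Fin n → Fin n → Set
DistGt G k x y = ∀ l → l ≤ k → ¬ Walk G l x y

KIndep : {n : ℕ} → Graph n → ℕ → (Fin n → Set) → Set
KIndep G k S = ∀ x y → S x → S y → x ≢ y → DistGt G k x y

part : {n : ℕ} → (Fin n → Fin 7) → Fin 7 → Subset n
part c i = tabulate (λ v → ⌊ c v ≟ i ⌋)

size : {n : ℕ} → (Fin n → Fin 7) → Fin 7 → ℕ
size c i = ∣ part c i ∣

-- Since H is maximal, its vertices of degree less than 2 are pairwise adjacent, so there are
-- at most three of them.  W₆ is chosen greedily among the degree-2 vertices, pairwise at
-- distance > 3; it reaches 2m vertices because otherwise every vertex would be one of the
-- deficient ones or lie in a radius-3 ball (at most 15 vertices) around one of fewer than 2m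
-- chosen ones, and 3 + 15 (2m - 1) < 1000m.  Then W₀ = N(W₆) has exactly 4m vertices.
-- The remaining vertices get five colours, equal colours at distance > 2: first each colour
-- greedily receives 2m seeds outside W₀ ∪ W₆ (every previously coloured vertex rules out at most
-- the 7 vertices of its radius-2 ball, and 6m + 7 · 10m < 1000m), then every other vertex takes
-- a colour unused among the at most four vertices at distance 1 or 2 from it.
module Submission where

open import Defs hiding (sym)
open import Data.Nat using (ℕ; _≤_; _*_)
open import Data.Fin using (Fin; #_)
open import Data.Product using (Σ; ∃; _×_)
open import Data.Bool using (true)
open import Function.Bundles using (_⇔_)
open import Relation.Binary.PropositionalEquality using (_≡_)

open import Level using (_⊔_)
open import Function.Base using (_∘_)
open import Function.Bundles using (module Equivalence; mk⇔)
open import Data.Nat using (zero; suc; _+_; _<_; z≤n; s≤s; _<?_)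
open import Data.Nat.Properties hiding (_≟_; suc-injective)
import Data.Nat as ℕ
open import Data.Nat.Tactic.RingSolver using (solve-∀)
open import Data.Bool using (Bool; false; if_then_else_)
import Data.Bool.Properties as Bool
open import Data.Fin using (zero; suc; inject₁)
open import Data.Fin.Properties using (_≟_; suc-injective; inject₁-injective; fromℕ≢inject₁)
open import Data.Fin.Subset using (∣_∣)
import Data.Vec as Vec
open import Data.Maybe using (Maybe; just; nothing)
open import Data.Maybe.Properties using (just-injective) renaming (≡-dec to ≡-decₘ)
open import Data.Product using (_,_; proj₁; proj₂)
open import Data.Sum as Sum using (_⊎_; inj₁; inj₂)
open import Data.List using (List; []; _∷_; _++_; [_]; length; filter; concatMap; allFin)
import Data.List as List
open import Data.List.Properties using (length-++; length-tabulate; filter-++; filter-notAll; filter-reject)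
open import Data.List.Membership.Propositional using (_∈_; _∉_; find; lose)
open import Data.List.Membership.Propositional.Properties
  using (∈-++⁺ˡ; ∈-++⁺ʳ; ∈-++⁻; ∈-∃++; ∈-filter⁺; ∈-filter⁻; ∈-allFin; ∈-concatMap⁺; ∈-concatMap⁻; ∈-map⁻)
open import Data.List.Relation.Binary.Subset.Propositional using (_⊆_)
open import Data.List.Relation.Binary.Disjoint.Propositional using (Disjoint)
open import Data.List.Relation.Unary.All as All using (All; []; _∷_)
open import Data.List.Relation.Unary.All.Properties using (¬All⇒Any¬)
open import Data.List.Relation.Unary.Any as Any using (Any; here; there)
open import Data.List.Relation.Unary.AllPairs as AllPairs using (AllPairs; []; _∷_)
open import Data.List.Relation.Unary.Unique.Propositional using (Unique)
import Data.List.Relation.Unary.Unique.Propositional.Properties as Unique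
open import Relation.Binary.Core using (Rel)
open import Relation.Binary.Definitions using (Symmetric) renaming (Decidable to Decidable₂)
open import Relation.Binary.PropositionalEquality
  using (_≢_; refl; sym; trans; cong; cong₂; subst; module ≡-Reasoning)
open import Relation.Nullary using (¬_; ¬?; Dec; yes; no; does; ⌊_⌋; contradiction)
open import Relation.Nullary.Decidable using (decidable-stable; _×-dec_; isYes≗does)
open import Relation.Unary using (Pred; Decidable)

module _ {A : Set} where

  Unique⇒length≤ : {xs ys : List A} → Unique xs → xs ⊆ ys → length xs ≤ length ys
  Unique⇒length≤ [] _ = z≤n
  Unique⇒length≤ {x ∷ xs} (x≢xs ∷ xs!) x∷xs⊆ys with ∈-∃++ (x∷xs⊆ys (here refl))
  ... | as , bs , refl = begin
    suc (length xs)            ≤⟨ s≤s (Unique⇒length≤ xs! xs⊆as++bs) ⟩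
    suc (length (as ++ bs))    ≡⟨ cong suc (length-++ as) ⟩
    suc (length as + length bs) ≡⟨ +-suc (length as) (length bs) ⟨
    length as + length (x ∷ bs) ≡⟨ length-++ as ⟨
    length (as ++ x ∷ bs)      ∎
    where
    open ≤-Reasoning
    xs⊆as++bs : xs ⊆ as ++ bs
    xs⊆as++bs {z} z∈xs with ∈-++⁻ as (x∷xs⊆ys (there z∈xs))
    ... | inj₁ z∈as = ∈-++⁺ˡ z∈as
    ... | inj₂ (here refl) = contradiction refl (All.lookup x≢xs z∈xs)
    ... | inj₂ (there z∈bs) = ∈-++⁺ʳ as z∈bs

  AllPairs-∈ : ∀ {ℓ} {R : Rel A ℓ} → Symmetric R → {xs : List A} → AllPairs R xs →
    ∀ {x y} → x ∈ xs → y ∈ xs → x ≢ y → R x y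
  AllPairs-∈ sym-R (Rx ∷ _) (here refl) (here refl) x≢y = contradiction refl x≢y
  AllPairs-∈ sym-R (Rx ∷ _) (here refl) (there y∈xs) _ = All.lookup Rx y∈xs
  AllPairs-∈ sym-R (Rx ∷ _) (there x∈xs) (here refl) _ = sym-R (All.lookup Rx x∈xs)
  AllPairs-∈ sym-R (_ ∷ pairs) (there x∈xs) (there y∈xs) x≢y = AllPairs-∈ sym-R pairs x∈xs y∈xs x≢y

module _ {A B : Set} (f : A → List B) where

  length-concatMap≤ : {b : ℕ} (xs : List A) →
    (∀ {x} → x ∈ xs → length (f x) ≤ b) → length (concatMap f xs) ≤ b * length xs
  length-concatMap≤ {b} [] _ = z≤n
  length-concatMap≤ {b} (x ∷ xs) bound = begin
    length (f x ++ concatMap f xs)        ≡⟨ length-++ (f x) ⟩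
    length (f x) + length (concatMap f xs) ≤⟨ +-mono-≤ (bound (here refl)) (length-concatMap≤ xs (bound ∘ there)) ⟩
    b + b * length xs                     ≡⟨ *-suc b (length xs) ⟨
    b * length (x ∷ xs)                   ∎
    where open ≤-Reasoning

  length-concatMap : {b : ℕ} (xs : List A) →
    (∀ {x} → x ∈ xs → length (f x) ≡ b) → length (concatMap f xs) ≡ b * length xs
  length-concatMap {b} [] _ = sym (*-zeroʳ b)
  length-concatMap {b} (x ∷ xs) size = begin
    length (f x ++ concatMap f xs)        ≡⟨ length-++ (f x) ⟩
    length (f x) + length (concatMap f xs) ≡⟨ cong₂ _+_ (size (here refl)) (length-concatMap xs (size ∘ there)) ⟩
    b + b * length xs                     ≡⟨ *-suc b (length xs) ⟨
    b * length (x ∷ xs)                   ∎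
    where open ≡-Reasoning

  Unique-concatMap : {xs : List A} → Unique xs →
    (∀ {x} → x ∈ xs → Unique (f x)) →
    (∀ {x y} → x ∈ xs → y ∈ xs → x ≢ y → Disjoint (f x) (f y)) →
    Unique (concatMap f xs)
  Unique-concatMap [] _ _ = []
  Unique-concatMap {x ∷ xs} (x≢xs ∷ xs!) unique disjoint =
    Unique.++⁺ (unique (here refl))
      (Unique-concatMap xs! (unique ∘ there) (λ p q → disjoint (there p) (there q)))
      λ (z∈fx , z∈rest) →
        let y , y∈xs , z∈fy = find (∈-concatMap⁻ f z∈rest)
        in disjoint (here refl) (there y∈xs) (All.lookup x≢xs y∈xs) (z∈fx , z∈fy)

  filter-concatMap : ∀ {ℓ} {P : Pred B ℓ} (P? : Decidable P) (xs : List A) →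
    filter P? (concatMap f xs) ≡ concatMap (filter P? ∘ f) xs
  filter-concatMap P? [] = refl
  filter-concatMap P? (x ∷ xs) =
    trans (filter-++ P? (f x) (concatMap f xs)) (cong (filter P? (f x) ++_) (filter-concatMap P? xs))

∣tabulate∣≡length-filter : ∀ {n ℓ} {B : Set} {P : Pred B ℓ} (P? : Decidable P)
  (g : Fin n → B) (f : Fin n → Bool) → (∀ i → does (P? (g i)) ≡ f i) →
  ∣ Vec.tabulate f ∣ ≡ length (filter P? (List.tabulate g))
∣tabulate∣≡length-filter {zero} P? g f agree = refl
∣tabulate∣≡length-filter {suc n} P? g f agree with does (P? (g zero)) | f zero | agree zero
... | true  | true  | refl = cong suc (∣tabulate∣≡length-filter P? (g ∘ suc) (f ∘ suc) (agree ∘ suc))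
... | false | false | refl = ∣tabulate∣≡length-filter P? (g ∘ suc) (f ∘ suc) (agree ∘ suc)

n≤length : ∀ {n} {xs : List (Fin n)} → (∀ i → i ∈ xs) → n ≤ length xs
n≤length {n} {xs} complete = subst (_≤ length xs) (length-tabulate {n = n} (λ i → i))
  (Unique⇒length≤ (Unique.allFin⁺ n) λ {i} _ → complete i)

module _ {n : ℕ} (c : Fin n → Fin 7) (i : Fin 7) where

  size≡length-filter : size c i ≡ length (filter (λ v → c v ≟ i) (allFin n))
  size≡length-filter = ∣tabulate∣≡length-filter (λ v → c v ≟ i) (λ v → v) (λ v → ⌊ c v ≟ i ⌋)
                                                 (λ v → sym (isYes≗does (c v ≟ i)))

  length≤size : ∀ {L} → Unique L → All (λ v → c v ≡ i) L → length L ≤ size c i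
  length≤size {L} unique inPart = subst (length L ≤_) (sym size≡length-filter)
    (Unique⇒length≤ unique (λ v∈L → ∈-filter⁺ (λ v → c v ≟ i) (∈-allFin _) (All.lookup inPart v∈L)))

  size≡length : ∀ {L} → Unique L → (∀ {v} → c v ≡ i ⇔ v ∈ L) → size c i ≡ length L
  size≡length {L} unique part⇔L = ≤-antisym
    (subst (_≤ length L) (sym size≡length-filter)
      (Unique⇒length≤ (Unique.filter⁺ _ (Unique.allFin⁺ n))
        (λ v∈ → Equivalence.to part⇔L (proj₂ (∈-filter⁻ (λ v → c v ≟ i) {xs = allFin n} v∈)))))
    (length≤size unique (All.tabulate (Equivalence.from part⇔L)))

module _ {n : ℕ} (a : Fin n → Fin n → Bool) where

  nbrs : Fin n → List (Fin n)
  nbrs x = filter (λ y → a x y Bool.≟ true) (allFin n)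

  ∈-nbrs⁺ : ∀ {x y} → a x y ≡ true → y ∈ nbrs x
  ∈-nbrs⁺ {y = y} = ∈-filter⁺ _ (∈-allFin y)

  ∈-nbrs⁻ : ∀ {x y} → y ∈ nbrs x → a x y ≡ true
  ∈-nbrs⁻ {x} y∈ = proj₂ (∈-filter⁻ (λ y → a x y Bool.≟ true) {xs = allFin n} y∈)

  length-nbrs : ∀ x → length (nbrs x) ≡ deg a x
  length-nbrs x = sym (∣tabulate∣≡length-filter _ (λ y → y) (a x) does-≟true)
    where
    does-≟true : ∀ y → does (a x y Bool.≟ true) ≡ a x y
    does-≟true y with a x y
    ... | true = refl
    ... | false = refl

  deg≤length : ∀ {x ys} → (∀ {y} → a x y ≡ true → y ∈ ys) → deg a x ≤ length ys
  deg≤length {x} {ys} covers = subst (_≤ length ys) (length-nbrs x)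
    (Unique⇒length≤ (Unique.filter⁺ _ (Unique.allFin⁺ n)) (covers ∘ ∈-nbrs⁻))

  addEdge-true : ∀ {u v x y} → addEdge a u v x y ≡ true →
                 a x y ≡ true ⊎ (x ≡ u × y ≡ v) ⊎ (x ≡ v × y ≡ u)
  addEdge-true {u} {v} {x} {y} e with a x y
  ... | true = inj₁ refl
  ... | false with x ≟ u | y ≟ v | x ≟ v | y ≟ u
  ...   | yes p | yes q | _     | _     = inj₂ (inj₁ (p , q))
  ...   | _     | _     | yes p | yes q = inj₂ (inj₂ (p , q))
  ...   | no _  | _     | no _  | _     = contradiction e λ ()
  ...   | no _  | _     | yes _ | no _  = contradiction e λ ()
  ...   | yes _ | no _  | no _  | _     = contradiction e λ ()
  ...   | yes _ | no _  | yes _ | no _  = contradiction e λ ()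

maxDeg2-addEdge : ∀ {n} (a : Fin n → Fin n → Bool) {u v} → MaxDeg2 a →
                  deg a u ≤ 1 → deg a v ≤ 1 → u ≢ v → MaxDeg2 (addEdge a u v)
maxDeg2-addEdge a {u} {v} maxDeg du dv u≢v x = bound (x ≟ u) (x ≟ v)
  where
  bound : Dec (x ≡ u) → Dec (x ≡ v) → deg (addEdge a u v) x ≤ 2
  bound (yes refl) (yes refl) = contradiction refl u≢v
  bound (yes refl) (no x≢v) = ≤-trans (deg≤length (addEdge a u v) (at-u ∘ addEdge-true a))
                                      (s≤s (subst (_≤ 1) (sym (length-nbrs a u)) du))
    where
    at-u : ∀ {y} → a u y ≡ true ⊎ (u ≡ u × y ≡ v) ⊎ (u ≡ v × y ≡ u) → y ∈ v ∷ nbrs a u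
    at-u (inj₁ e) = there (∈-nbrs⁺ a e)
    at-u (inj₂ (inj₁ (_ , refl))) = here refl
    at-u (inj₂ (inj₂ (u≡v , _))) = contradiction u≡v u≢v
  bound (no x≢u) (yes refl) = ≤-trans (deg≤length (addEdge a u v) (at-v ∘ addEdge-true a))
                                      (s≤s (subst (_≤ 1) (sym (length-nbrs a v)) dv))
    where
    at-v : ∀ {y} → a v y ≡ true ⊎ (v ≡ u × y ≡ v) ⊎ (v ≡ v × y ≡ u) → y ∈ u ∷ nbrs a v
    at-v (inj₁ e) = there (∈-nbrs⁺ a e)
    at-v (inj₂ (inj₁ (v≡u , _))) = contradiction (sym v≡u) u≢v
    at-v (inj₂ (inj₂ (_ , refl))) = here refl
  bound (no x≢u) (no x≢v) = ≤-trans (deg≤length (addEdge a u v) (elsewhere ∘ addEdge-true a))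
                                    (subst (_≤ 2) (sym (length-nbrs a x)) (maxDeg x))
    where
    elsewhere : ∀ {y} → a x y ≡ true ⊎ (x ≡ u × y ≡ v) ⊎ (x ≡ v × y ≡ u) → y ∈ nbrs a x
    elsewhere (inj₁ e) = ∈-nbrs⁺ a e
    elsewhere (inj₂ (inj₁ (x≡u , _))) = contradiction x≡u x≢u
    elsewhere (inj₂ (inj₂ (x≡v , _))) = contradiction x≡v x≢v

d+c*a<c*b : ∀ {a b c d} → d < c → a < b → d + c * a < c * b
d+c*a<c*b {a} {b} {c} {d} d<c a<b = begin-strict
  d + c * a  <⟨ +-monoˡ-< (c * a) d<c ⟩
  c + c * a  ≡⟨ *-suc c a ⟨
  c * suc a  ≤⟨ *-monoʳ-≤ c a<b ⟩
  c * b      ∎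
  where open ≤-Reasoning

module Greedy {A : Set} {p q} {Cand : Pred A p} (cand? : Decidable Cand)
              {Far : Rel A q} (far? : Decidable₂ Far) (far-irrefl : ∀ x → ¬ Far x x)
              (cap : ℕ) where

  Blocked : List A → A → Set (p ⊔ q)
  Blocked chosen v = cap ≤ length chosen ⊎ ¬ Cand v ⊎ Any (λ w → ¬ Far v w) chosen

  record Selection (candidates : List A) : Set (p ⊔ q) where
    field
      chosen      : List A
      chosen≤cap  : length chosen ≤ cap
      chosen-cand : All Cand chosen
      chosen-far  : AllPairs Far chosen
      saturated   : ∀ {v} → v ∈ candidates → Blocked chosen v

  open Selection

  reject : ∀ {v vs} (S : Selection vs) → Blocked (chosen S) v → Selection (v ∷ vs)
  reject S blocked = record
    { chosen = chosen S
    ; chosen≤cap = chosen≤cap S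
    ; chosen-cand = chosen-cand S
    ; chosen-far = chosen-far S
    ; saturated = λ where
        (here refl) → blocked
        (there u∈vs) → saturated S u∈vs }

  accept : ∀ {v vs} (S : Selection vs) → length (chosen S) < cap → Cand v → All (Far v) (chosen S) →
           Selection (v ∷ vs)
  accept {v} S room cand far = record
    { chosen = v ∷ chosen S
    ; chosen≤cap = room
    ; chosen-cand = cand ∷ chosen-cand S
    ; chosen-far = far ∷ chosen-far S
    ; saturated = λ where
        (here refl) → inj₂ (inj₂ (here (far-irrefl v)))
        (there u∈vs) → grow (saturated S u∈vs) }
    where
    grow : ∀ {u} → Blocked (chosen S) u → Blocked (v ∷ chosen S) u
    grow (inj₁ full) = inj₁ (m≤n⇒m≤1+n full)
    grow (inj₂ (inj₁ ¬cand)) = inj₂ (inj₁ ¬cand)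
    grow (inj₂ (inj₂ near)) = inj₂ (inj₂ (there near))

  select : (candidates : List A) → Selection candidates
  select [] = record
    { chosen = [] ; chosen≤cap = z≤n ; chosen-cand = [] ; chosen-far = [] ; saturated = λ () }
  select (v ∷ vs) with S ← select vs
    | length (chosen S) <? cap | cand? v | All.all? (far? v) (chosen S)
  ... | yes room | yes cand | yes far = accept S room cand far
  ... | no full  | _        | _       = reject S (inj₁ (≮⇒≥ full))
  ... | yes _    | no ¬cand | _       = reject S (inj₂ (inj₁ ¬cand))
  ... | yes _    | yes _    | no ¬far = reject S (inj₂ (inj₂ (¬All⇒Any¬ (far? v) _ ¬far)))

module MaxDeg2Graph {N : ℕ} (H : Graph N) (maxDeg2 : MaxDeg2 (adj H)) where

  open import Data.List.Membership.DecPropositional (_≟_ {N}) using (_∈?_)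

  length-nbrs≤2 : ∀ x → length (nbrs (adj H) x) ≤ 2
  length-nbrs≤2 x = subst (_≤ 2) (sym (length-nbrs (adj H) x)) (maxDeg2 x)

  adj-sym : ∀ {x y} → adj H x y ≡ true → adj H y x ≡ true
  adj-sym {x} {y} e = trans (Graph.sym H y x) e

  adj⇒≢ : ∀ {x y} → adj H x y ≡ true → x ≢ y
  adj⇒≢ {x} e refl = contradiction (trans (sym e) (irrefl H x)) λ ()

  walk-snoc : ∀ {l x y z} → Walk H l x y → adj H y z ≡ true → Walk H (suc l) x z
  walk-snoc here e = step e here
  walk-snoc (step e′ w) e = step e′ (walk-snoc w e)

  walk-reverse : ∀ {l x y} → Walk H l x y → Walk H l y x
  walk-reverse here = here
  walk-reverse (step e w) = walk-snoc (walk-reverse w) (adj-sym e)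

  DistGt-sym : ∀ {k x y} → DistGt H k x y → DistGt H k y x
  DistGt-sym far l l≤k w = far l l≤k (walk-reverse w)

  DistGt-irrefl : ∀ k x → ¬ DistGt H k x x
  DistGt-irrefl k x far = far 0 z≤n here

  AllPairs-DistGt⇒Unique : ∀ {r L} → AllPairs (DistGt H r) L → Unique L
  AllPairs-DistGt⇒Unique {r} = AllPairs.map (λ { far refl → DistGt-irrefl r _ far })

  ball : ℕ → Fin N → List (Fin N)
  ball zero x = [ x ]
  ball (suc r) x = x ∷ concatMap (ball r) (nbrs (adj H) x)

  x∈ball : ∀ r x → x ∈ ball r x
  x∈ball zero x = here refl
  x∈ball (suc r) x = here refl

  walk⇒∈ball : ∀ {r l x y} → l ≤ r → Walk H l x y → y ∈ ball r x
  walk⇒∈ball {r} _ here = x∈ball r _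
  walk⇒∈ball {suc r} (s≤s l≤r) (step e w) =
    there (∈-concatMap⁺ (ball r) (Any.map (λ { refl → walk⇒∈ball l≤r w }) (∈-nbrs⁺ (adj H) e)))

  ∈ball⇒walk : ∀ {r x y} → y ∈ ball r x → ∃ λ l → l ≤ r × Walk H l x y
  ∈ball⇒walk {zero} (here refl) = 0 , z≤n , here
  ∈ball⇒walk {suc r} (here refl) = 0 , z≤n , here
  ∈ball⇒walk {suc r} {x} (there y∈) with u , u∈nbrs , y∈ball ← find (∈-concatMap⁻ (ball r) y∈)
    with l , l≤r , w ← ∈ball⇒walk y∈ball =
    suc l , s≤s l≤r , step (∈-nbrs⁻ (adj H) u∈nbrs) w

  ball-sym : ∀ r {x y} → y ∈ ball r x → x ∈ ball r y
  ball-sym r y∈ with l , l≤r , w ← ∈ball⇒walk y∈ = walk⇒∈ball l≤r (walk-reverse w)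

  DistGt⇒∉ball : ∀ {r x y} → DistGt H r x y → y ∉ ball r x
  DistGt⇒∉ball far y∈ with l , l≤r , w ← ∈ball⇒walk y∈ = far l l≤r w

  ∉ball⇒DistGt : ∀ {r x y} → y ∉ ball r x → DistGt H r x y
  ∉ball⇒DistGt y∉ l l≤r w = y∉ (walk⇒∈ball l≤r w)

  ¬DistGt⇒∈ball : ∀ {r x y} → ¬ DistGt H r x y → y ∈ ball r x
  ¬DistGt⇒∈ball {r} {x} {y} near with y ∈? ball r x
  ... | yes y∈ = y∈
  ... | no y∉ = contradiction (∉ball⇒DistGt y∉) near

  distGt? : ∀ r → Decidable₂ (DistGt H r)
  distGt? r x y with y ∈? ball r x
  ... | yes y∈ = no λ far → DistGt⇒∉ball far y∈
  ... | no y∉ = yes (∉ball⇒DistGt y∉)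

  ballSize : ℕ → ℕ
  ballSize zero = 1
  ballSize (suc r) = suc (2 * ballSize r)

  length-ball : ∀ r x → length (ball r x) ≤ ballSize r
  length-ball zero x = ≤-refl
  length-ball (suc r) x = s≤s (begin
    length (concatMap (ball r) (nbrs (adj H) x)) ≤⟨ length-concatMap≤ (ball r) (nbrs (adj H) x) (λ _ → length-ball r _) ⟩
    ballSize r * length (nbrs (adj H) x)         ≤⟨ *-monoʳ-≤ (ballSize r) (length-nbrs≤2 x) ⟩
    ballSize r * 2                               ≡⟨ *-comm (ballSize r) 2 ⟩
    2 * ballSize r                               ∎)
    where open ≤-Reasoning

  ≢? : (x : Fin N) → Decidable (_≢ x)
  ≢? x y = ¬? (y ≟ x)

  around : Fin N → List (Fin N)
  around x = filter (≢? x) (ball 2 x)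

  walk⇒∈around : ∀ {l x y} → l ≤ 2 → Walk H l x y → y ≢ x → y ∈ around x
  walk⇒∈around {x = x} l≤2 w y≢x = ∈-filter⁺ (≢? x) (walk⇒∈ball l≤2 w) y≢x

  ∈around⇒∈ball : ∀ {x y} → y ∈ around x → x ∈ ball 2 y
  ∈around⇒∈ball {x} y∈ = ball-sym 2 (proj₁ (∈-filter⁻ (≢? x) {xs = ball 2 x} y∈))

  length-around : ∀ x → length (around x) ≤ 4
  length-around x = begin
    length (filter ≢x? (ball 2 x))                              ≡⟨ cong length (filter-reject ≢x? (λ x≢x → x≢x refl)) ⟩
    length (filter ≢x? (concatMap (ball 1) (nbrs (adj H) x)))   ≡⟨ cong length (filter-concatMap (ball 1) ≢x? (nbrs (adj H) x)) ⟩
    length (concatMap (filter ≢x? ∘ ball 1) (nbrs (adj H) x))   ≤⟨ length-concatMap≤ (filter ≢x? ∘ ball 1) (nbrs (adj H) x) shrunk ⟩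
    2 * length (nbrs (adj H) x)                                 ≤⟨ *-monoʳ-≤ 2 (length-nbrs≤2 x) ⟩
    4                                                           ∎
    where
    open ≤-Reasoning
    ≢x? = ≢? x
    shrunk : ∀ {u} → u ∈ nbrs (adj H) x → length (filter ≢x? (ball 1 u)) ≤ 2
    shrunk {u} u∈ = ≤-pred (≤-trans (filter-notAll ≢x? (ball 1 u) x-rejected) (length-ball 1 u))
      where
      x-rejected : Any (λ y → ¬ y ≢ x) (ball 1 u)
      x-rejected = Any.map (λ { refl x≢x → x≢x refl })
                     (walk⇒∈ball ≤-refl (step (adj-sym (∈-nbrs⁻ (adj H) u∈)) here))

module DistanceTwoColouring {N : ℕ} (H : Graph N) (maxDeg2 : MaxDeg2 (adj H)) where

  open MaxDeg2Graph H maxDeg2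
  open import Data.List.Membership.DecPropositional (_≟_ {N}) using (_∈?_)

  Colouring : Set
  Colouring = Fin N → Maybe (Fin 5)

  Proper : Colouring → Set
  Proper σ = ∀ {x y j} → σ x ≡ just j → σ y ≡ just j → x ≢ y → DistGt H 2 x y

  _⊑_ : Colouring → Colouring → Set
  σ ⊑ τ = ∀ {v j} → σ v ≡ just j → τ v ≡ just j

  _≟ₘ_ : (a b : Maybe (Fin 5)) → Dec (a ≡ b)
  _≟ₘ_ = ≡-decₘ _≟_

  Free : Colouring → Fin 5 → Fin N → Set
  Free σ j v = ¬ Any (λ w → σ w ≡ just j) (around v)

  free? : ∀ σ j v → Dec (Free σ j v)
  free? σ j v = ¬? (Any.any? (λ w → σ w ≟ₘ just j) (around v))

  Free⇒DistGt : ∀ {σ j v y} → Free σ j v → σ y ≡ just j → y ≢ v → DistGt H 2 v y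
  Free⇒DistGt free σy y≢v l l≤2 w = free (lose (walk⇒∈around l≤2 w y≢v) σy)

  some-free : ∀ σ v → ∃ λ j → Free σ j v
  some-free σ v with Any.any? (λ j → free? σ j v) (allFin 5)
  ... | yes some = let j , _ , free = find some in j , free
  ... | no none = contradiction (Unique⇒length≤ blockers-unique blockers⊆around) (<⇒≱ (s≤s (length-around v)))
    where
    blocker : (j : Fin 5) → ∃ λ w → w ∈ around v × σ w ≡ just j
    blocker j = find (decidable-stable (Any.any? (λ w → σ w ≟ₘ just j) (around v))
                                       (λ free → none (lose (∈-allFin j) free)))
    blockers = List.map (proj₁ ∘ blocker) (allFin 5)
    blockers-unique : Unique blockers
    blockers-unique = Unique.map⁺ (λ {i} {j} same → just-injective
      (trans (sym (proj₂ (proj₂ (blocker i)))) (trans (cong σ same) (proj₂ (proj₂ (blocker j))))))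
      (Unique.allFin⁺ 5)
    blockers⊆around : blockers ⊆ around v
    blockers⊆around w∈ with j , _ , refl ← ∈-map⁻ (proj₁ ∘ blocker) w∈ = proj₁ (proj₂ (blocker j))

  paint : Colouring → List (Fin N) → Fin 5 → Colouring
  paint σ L j v = if does (v ∈? L) then just j else σ v

  paint-∈ : ∀ {σ L j v} → v ∈ L → paint σ L j v ≡ just j
  paint-∈ {L = L} {v = v} v∈L with v ∈? L
  ... | yes _ = refl
  ... | no v∉L = contradiction v∈L v∉L

  paint-just : ∀ {σ L j v k} → paint σ L j v ≡ just k → (v ∈ L × j ≡ k) ⊎ (v ∉ L × σ v ≡ just k)
  paint-just {L = L} {v = v} painted with v ∈? L
  ... | yes v∈L = inj₁ (v∈L , just-injective painted)
  ... | no v∉L = inj₂ (v∉L , painted)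

  paint-extends : ∀ {σ L j} → All (λ v → σ v ≡ nothing) L → σ ⊑ paint σ L j
  paint-extends {σ} {L} blank {v} σv with v ∈? L
  ... | yes v∈L = contradiction (trans (sym σv) (All.lookup blank v∈L)) λ ()
  ... | no _ = σv

  paint-proper : ∀ {σ L j} → Proper σ → AllPairs (DistGt H 2) L → All (Free σ j) L →
                 Proper (paint σ L j)
  paint-proper {σ} {L} {j} proper far free {x} {y} σx σy x≢y
    with paint-just {σ} {L} {j} σx | paint-just {σ} {L} {j} σy
  ... | inj₁ (x∈L , _) | inj₁ (y∈L , _) = AllPairs-∈ DistGt-sym far x∈L y∈L x≢y
  ... | inj₁ (x∈L , refl) | inj₂ (_ , σy′) = Free⇒DistGt (All.lookup free x∈L) σy′ (x≢y ∘ sym)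
  ... | inj₂ (_ , σx′) | inj₁ (y∈L , refl) = DistGt-sym (Free⇒DistGt (All.lookup free y∈L) σx′ x≢y)
  ... | inj₂ (_ , σx′) | inj₂ (_ , σy′) = proper σx′ σy′ x≢y

  fillAt : Colouring → Fin N → Colouring
  fillAt σ v with σ v
  ... | just _ = σ
  ... | nothing = paint σ [ v ] (proj₁ (some-free σ v))

  fillAt-proper : ∀ {σ} v → Proper σ → Proper (fillAt σ v)
  fillAt-proper {σ} v proper with σ v
  ... | just _ = proper
  ... | nothing = paint-proper proper ([] ∷ []) (proj₂ (some-free σ v) ∷ [])

  fillAt-extends : ∀ {σ} v → σ ⊑ fillAt σ v
  fillAt-extends {σ} v with σ v in σv
  ... | just _ = λ σw → σw
  ... | nothing = paint-extends {σ} {[ v ]} (σv ∷ [])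

  fillAt-colours : ∀ σ v → ∃ λ j → fillAt σ v v ≡ just j
  fillAt-colours σ v with σ v in σv
  ... | just j = j , σv
  ... | nothing = proj₁ (some-free σ v) , paint-∈ {σ} {[ v ]} (here refl)

  fill : Colouring → List (Fin N) → Colouring
  fill σ [] = σ
  fill σ (v ∷ vs) = fillAt (fill σ vs) v

  fill-proper : ∀ {σ} → Proper σ → ∀ vs → Proper (fill σ vs)
  fill-proper proper [] = proper
  fill-proper proper (v ∷ vs) = fillAt-proper v (fill-proper proper vs)

  fill-extends : ∀ {σ} vs → σ ⊑ fill σ vs
  fill-extends [] = λ σv → σv
  fill-extends {σ} (v ∷ vs) = fillAt-extends {fill σ vs} v ∘ fill-extends vs

  fill-colours : ∀ σ {vs v} → v ∈ vs → ∃ λ j → fill σ vs v ≡ just j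
  fill-colours σ {v ∷ vs} (here refl) = fillAt-colours (fill σ vs) v
  fill-colours σ {w ∷ vs} (there v∈vs) with j , coloured ← fill-colours σ v∈vs = j , fillAt-extends {fill σ vs} w coloured

  module SeedPhase (E : List (Fin N)) (σ : Colouring) (j : Fin 5) (s : ℕ) where

    Seedable : Fin N → Set
    Seedable v = v ∉ E × σ v ≡ nothing × Free σ j v

    seedable? : Decidable Seedable
    seedable? v = ¬? (v ∈? E) ×-dec (σ v ≟ₘ nothing) ×-dec free? σ j v

    open Greedy seedable? (distGt? 2) (DistGt-irrefl 2) s
    open Selection (select (allFin N)) public renaming (chosen to seeds)

    unseedable : ∀ {v} → ¬ Seedable v →
                 v ∈ E ⊎ (∃ λ k → σ v ≡ just k) ⊎ Any (λ w → σ w ≡ just j) (around v)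
    unseedable {v} ¬seedable with v ∈? E | σ v | free? σ j v
    ... | yes v∈E | _ | _ = inj₁ v∈E
    ... | no _ | just k | _ = inj₂ (inj₁ (k , refl))
    ... | no v∉E | nothing | yes free = contradiction (v∉E , refl , free) ¬seedable
    ... | no _ | nothing | no blocked =
      inj₂ (inj₂ (decidable-stable (Any.any? (λ w → σ w ≟ₘ just j) (around v)) blocked))

    within-ball : (C : List (Fin N)) → ∀ {w v} → w ∈ seeds ++ C → v ∈ ball 2 w →
                  v ∈ E ++ concatMap (ball 2) (seeds ++ C)
    within-ball C w∈ v∈ = ∈-++⁺ʳ E (∈-concatMap⁺ (ball 2) (lose w∈ v∈))

    module _ (C : List (Fin N)) (support⊆C : ∀ {v k} → σ v ≡ just k → v ∈ C) where

      seeds-cover : length seeds < s → ∀ v → v ∈ E ++ concatMap (ball 2) (seeds ++ C)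
      seeds-cover short v with saturated (∈-allFin v)
      ... | inj₁ full = contradiction full (<⇒≱ short)
      ... | inj₂ (inj₂ near) with w , w∈ , ¬far ← find near =
        within-ball C (∈-++⁺ˡ w∈) (ball-sym 2 (¬DistGt⇒∈ball ¬far))
      ... | inj₂ (inj₁ ¬seedable) with unseedable ¬seedable
      ...   | inj₁ v∈E = ∈-++⁺ˡ v∈E
      ...   | inj₂ (inj₁ (_ , σv)) = within-ball C (∈-++⁺ʳ seeds (support⊆C σv)) (x∈ball 2 v)
      ...   | inj₂ (inj₂ blocked) with w , w∈ , σw ← find blocked =
        within-ball C (∈-++⁺ʳ seeds (support⊆C σw)) (∈around⇒∈ball w∈)

      length-seeds : length E + 7 * (s + length C) ≤ N → length seeds ≡ s
      length-seeds room with m≤n⇒m<n∨m≡n chosen≤cap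
      ... | inj₂ full = full
      ... | inj₁ short = contradiction (begin
        N                                                   ≤⟨ n≤length (seeds-cover short) ⟩
        length (E ++ concatMap (ball 2) (seeds ++ C))       ≡⟨ length-++ E ⟩
        length E + length (concatMap (ball 2) (seeds ++ C)) ≤⟨ +-monoʳ-≤ (length E)
                                                               (length-concatMap≤ (ball 2) (seeds ++ C) (λ _ → length-ball 2 _)) ⟩
        length E + 7 * length (seeds ++ C)                  ∎)
        (<⇒≱ (<-≤-trans (+-monoʳ-< (length E) (*-monoʳ-< 7 fewer)) room))
        where
        open ≤-Reasoning
        fewer : length (seeds ++ C) < s + length C
        fewer = subst (_< s + length C) (sym (length-++ seeds)) (+-monoˡ-< (length C) short)

  Seeds : List (Fin N) → ℕ → Colouring → Fin 5 → Set
  Seeds E s σ j = ∃ λ L → length L ≡ s × Unique L × All (_∉ E) L × All (λ v → σ v ≡ just j) L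

  Seeds-⊑ : ∀ {E s σ τ j} → σ ⊑ τ → Seeds E s σ j → Seeds E s τ j
  Seeds-⊑ σ⊑τ (L , size , unique , outside , coloured) = L , size , unique , outside , All.map σ⊑τ coloured

  record Seeding (E : List (Fin N)) (s : ℕ) (js : List (Fin 5)) : Set where
    field
      colouring       : Colouring
      proper          : Proper colouring
      coloured        : List (Fin N)
      support⊆coloured : ∀ {v j} → colouring v ≡ just j → v ∈ coloured
      length-coloured : length coloured ≤ s * length js
      seeded          : ∀ {j} → j ∈ js → Seeds E s colouring j

  seeding : ∀ E s js → length E + 7 * (s * length js) ≤ N → Seeding E s js
  seeding E s [] _ = record
    { colouring = λ _ → nothing ; proper = λ () ; coloured = [] ; support⊆coloured = λ ()
    ; length-coloured = z≤n ; seeded = λ () }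
  seeding E s (j ∷ js) room = record
    { colouring = paint σ seeds j
    ; proper = paint-proper (proper prev) chosen-far (All.map (proj₂ ∘ proj₂) chosen-cand)
    ; coloured = seeds ++ coloured prev
    ; support⊆coloured = λ painted →
        Sum.[ ∈-++⁺ˡ ∘ proj₁ , ∈-++⁺ʳ seeds ∘ support⊆coloured prev ∘ proj₂ ] (paint-just {σ} {seeds} painted)
    ; length-coloured = begin
        length (seeds ++ coloured prev)       ≡⟨ length-++ seeds ⟩
        length seeds + length (coloured prev) ≤⟨ +-monoˡ-≤ (length (coloured prev)) chosen≤cap ⟩
        s + length (coloured prev)            ≤⟨ s+coloured≤ ⟩
        s * length (j ∷ js)                   ∎
    ; seeded = λ where
        (here refl) → seeds , length-seeds (coloured prev) (support⊆coloured prev) room′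
                            , AllPairs-DistGt⇒Unique chosen-far , All.map proj₁ chosen-cand
                            , All.tabulate (paint-∈ {σ} {seeds})
        (there j∈js) → Seeds-⊑ (paint-extends {σ} {seeds} {j} (All.map (proj₁ ∘ proj₂) chosen-cand))
                               (seeded prev j∈js) }
    where
    open ≤-Reasoning
    open Seeding
    prev : Seeding E s js
    prev = seeding E s js (≤-trans (+-monoʳ-≤ (length E) (*-monoʳ-≤ 7 (*-monoʳ-≤ s (n≤1+n _)))) room)
    σ = colouring prev
    open SeedPhase E σ j s
    s+coloured≤ : s + length (coloured prev) ≤ s * length (j ∷ js)
    s+coloured≤ = ≤-trans (+-monoʳ-≤ s (length-coloured prev)) (≤-reflexive (sym (*-suc s (length js))))
    room′ : length E + 7 * (s + length (coloured prev)) ≤ N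
    room′ = ≤-trans (+-monoʳ-≤ (length E) (*-monoʳ-≤ 7 s+coloured≤)) room

module MaximalGraph {N : ℕ} (H : Graph N) (maximal : MaximalF2 H) where

  open MaxDeg2Graph H (proj₁ maximal) public

  Deficient : Fin N → Set
  Deficient v = deg (adj H) v ≢ 2

  deficient? : Decidable Deficient
  deficient? v = ¬? (deg (adj H) v ℕ.≟ 2)

  deficient⇒deg≤1 : ∀ {v} → Deficient v → deg (adj H) v ≤ 1
  deficient⇒deg≤1 {v} deficient with m≤n⇒m<n∨m≡n (proj₁ maximal v)
  ... | inj₁ deg<2 = ≤-pred deg<2
  ... | inj₂ deg≡2 = contradiction deg≡2 deficient

  deficient-adjacent : ∀ {u v} → Deficient u → Deficient v → u ≢ v → adj H u v ≡ true
  deficient-adjacent {u} {v} du dv u≢v with adj H u v in uv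
  ... | true = refl
  ... | false = contradiction
    (maxDeg2-addEdge (adj H) (proj₁ maximal) (deficient⇒deg≤1 du) (deficient⇒deg≤1 dv) u≢v)
    (proj₂ maximal u v u≢v uv)

  deficient-cover : ∃ λ D → length D ≤ 3 × (∀ {v} → Deficient v → v ∈ D)
  deficient-cover with Any.any? deficient? (allFin N)
  ... | no none = [] , z≤n , λ {v} dv → contradiction (lose (∈-allFin v) dv) none
  ... | yes some with d , _ , dd ← find some =
    d ∷ nbrs (adj H) d , s≤s (length-nbrs≤2 d) , covered
    where
    covered : ∀ {v} → Deficient v → v ∈ d ∷ nbrs (adj H) d
    covered {v} dv with v ≟ d
    ... | yes refl = here refl
    ... | no v≢d = there (∈-nbrs⁺ (adj H) (deficient-adjacent dd dv (v≢d ∘ sym)))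

  record Hubs (k : ℕ) : Set where
    field
      hubs        : List (Fin N)
      length-hubs : length hubs ≡ k
      hubs-deg2   : All (λ v → deg (adj H) v ≡ 2) hubs
      hubs-far    : AllPairs (DistGt H 3) hubs

  find-hubs : (k : ℕ) → 15 * k ≤ N → Hubs k
  find-hubs k room = record
    { hubs = chosen ; length-hubs = exact ; hubs-deg2 = chosen-cand ; hubs-far = chosen-far }
    where
    open Greedy (λ v → deg (adj H) v ℕ.≟ 2) (distGt? 3) (DistGt-irrefl 3) k
    open Selection (select (allFin N))
    D = proj₁ deficient-cover
    covered : length chosen < k → ∀ v → v ∈ D ++ concatMap (ball 3) chosen
    covered short v with saturated (∈-allFin v)
    ... | inj₁ full = contradiction full (<⇒≱ short)
    ... | inj₂ (inj₁ deficient) = ∈-++⁺ˡ (proj₂ (proj₂ deficient-cover) deficient)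
    ... | inj₂ (inj₂ near) with w , w∈ , ¬far ← find near =
      ∈-++⁺ʳ D (∈-concatMap⁺ (ball 3) (lose w∈ (ball-sym 3 (¬DistGt⇒∈ball ¬far))))
    exact : length chosen ≡ k
    exact with m≤n⇒m<n∨m≡n chosen≤cap
    ... | inj₂ full = full
    ... | inj₁ short = contradiction (begin
      N                                            ≤⟨ n≤length (covered short) ⟩
      length (D ++ concatMap (ball 3) chosen)      ≡⟨ length-++ D ⟩
      length D + length (concatMap (ball 3) chosen) ≤⟨ +-mono-≤ (proj₁ (proj₂ deficient-cover))
                                                        (length-concatMap≤ (ball 3) chosen (λ _ → length-ball 3 _)) ⟩
      3 + 15 * length chosen                       ∎) (<⇒≱ (<-≤-trans (d+c*a<c*b {d = 3} (m≤m+n 4 11) short) room))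
      where open ≤-Reasoning

module Partition {N : ℕ} (H : Graph N) (maximal : MaximalF2 H) (k s : ℕ)
                 (hub-room : 15 * k ≤ N) (seed-room : 3 * k + 7 * (s * 5) ≤ N) where

  open MaximalGraph H maximal
  open DistanceTwoColouring H (proj₁ maximal)
  open import Data.List.Membership.DecPropositional (_≟_ {N}) using (_∈?_)

  open Hubs (find-hubs k hub-room)
    renaming (hubs to W₆; length-hubs to length-W₆; hubs-deg2 to W₆-deg; hubs-far to W₆-far)

  W₀ : List (Fin N)
  W₀ = concatMap (nbrs (adj H)) W₆

  ∈W₀⇔ : ∀ {v} → v ∈ W₀ ⇔ (∃ λ u → u ∈ W₆ × adj H u v ≡ true)
  ∈W₀⇔ = mk⇔ (λ v∈ → let u , u∈ , v∈nbrs = find (∈-concatMap⁻ (nbrs (adj H)) v∈) in u , u∈ , ∈-nbrs⁻ (adj H) v∈nbrs)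
             (λ (u , u∈ , uv) → ∈-concatMap⁺ (nbrs (adj H)) (lose u∈ (∈-nbrs⁺ (adj H) uv)))

  W₀-unique : Unique W₀
  W₀-unique = Unique-concatMap (nbrs (adj H)) (AllPairs-DistGt⇒Unique W₆-far)
    (λ _ → Unique.filter⁺ _ (Unique.allFin⁺ N))
    (λ x∈ y∈ x≢y (z∈x , z∈y) → AllPairs-∈ DistGt-sym W₆-far x∈ y∈ x≢y 2 (s≤s (s≤s z≤n))
      (step (∈-nbrs⁻ (adj H) z∈x) (step (adj-sym (∈-nbrs⁻ (adj H) z∈y)) here)))

  length-W₀ : length W₀ ≡ 2 * k
  length-W₀ = trans (length-concatMap (nbrs (adj H)) W₆ (λ u∈ → trans (length-nbrs (adj H) _) (All.lookup W₆-deg u∈)))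
                    (cong (2 *_) length-W₆)

  W₀∉W₆ : ∀ {v} → v ∈ W₀ → v ∉ W₆
  W₀∉W₆ v∈ v∈W₆ with u , u∈ , uv ← Equivalence.to ∈W₀⇔ v∈ =
    AllPairs-∈ DistGt-sym W₆-far u∈ v∈W₆ (adj⇒≢ uv) 1 (s≤s z≤n) (step uv here)

  -- Opaque because unfolding the five seeding rounds exhausts the type checker's memory.
  opaque
    initial : Seeding (W₆ ++ W₀) s (allFin 5)
    initial = seeding (W₆ ++ W₀) s (allFin 5)
      (subst (λ e → e + 7 * (s * 5) ≤ N) (sym (trans (length-++ W₆) (cong₂ _+_ length-W₆ length-W₀))) seed-room)

  σ : Colouring
  σ = fill (Seeding.colouring initial) (allFin N)

  σ-proper : Proper σ
  σ-proper = fill-proper (Seeding.proper initial) (allFin N)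

  σ-extends : Seeding.colouring initial ⊑ σ
  σ-extends = fill-extends (allFin N)

  colour : Fin N → Fin 5
  colour v = proj₁ (fill-colours (Seeding.colouring initial) (∈-allFin v))

  σ≡colour : ∀ v → σ v ≡ just (colour v)
  σ≡colour v = proj₂ (fill-colours (Seeding.colouring initial) (∈-allFin v))

  class : Fin N → Fin 7
  class v with v ∈? W₆ | v ∈? W₀
  ... | yes _ | _     = # 6
  ... | no _  | yes _ = # 0
  ... | no _  | no _  = suc (inject₁ (colour v))

  class≡6⇔ : ∀ {v} → class v ≡ # 6 ⇔ v ∈ W₆
  class≡6⇔ {v} = mk⇔ to from
    where
    to : class v ≡ # 6 → v ∈ W₆
    to eq with v ∈? W₆ | v ∈? W₀
    ... | yes v∈ | _ = v∈
    ... | no _ | yes _ = contradiction eq λ ()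
    ... | no _ | no _ = contradiction (suc-injective eq) (fromℕ≢inject₁ ∘ sym)
    from : v ∈ W₆ → class v ≡ # 6
    from v∈ with v ∈? W₆
    ... | yes _ = refl
    ... | no v∉ = contradiction v∈ v∉

  class≡0⇔ : ∀ {v} → class v ≡ # 0 ⇔ v ∈ W₀
  class≡0⇔ {v} = mk⇔ to from
    where
    to : class v ≡ # 0 → v ∈ W₀
    to eq with v ∈? W₆ | v ∈? W₀
    ... | yes _ | _ = contradiction eq λ ()
    ... | no _ | yes v∈ = v∈
    ... | no _ | no _ = contradiction eq λ ()
    from : v ∈ W₀ → class v ≡ # 0
    from v∈ with v ∈? W₆ | v ∈? W₀
    ... | yes v∈W₆ | _ = contradiction v∈W₆ (W₀∉W₆ v∈)
    ... | no _ | yes _ = refl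
    ... | no _ | no v∉ = contradiction v∈ v∉

  class≡colour⇔ : ∀ {v j} → class v ≡ suc (inject₁ j) ⇔ (v ∉ W₆ ++ W₀ × σ v ≡ just j)
  class≡colour⇔ {v} {j} = mk⇔ to from
    where
    to : class v ≡ suc (inject₁ j) → v ∉ W₆ ++ W₀ × σ v ≡ just j
    to eq with v ∈? W₆ | v ∈? W₀
    ... | yes _ | _ = contradiction (suc-injective eq) fromℕ≢inject₁
    ... | no _ | yes _ = contradiction eq λ ()
    ... | no v∉W₆ | no v∉W₀ = (λ v∈ → Sum.[ v∉W₆ , v∉W₀ ] (∈-++⁻ W₆ v∈))
                            , trans (σ≡colour v) (cong just (inject₁-injective (suc-injective eq)))
    from : v ∉ W₆ ++ W₀ × σ v ≡ just j → class v ≡ suc (inject₁ j)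
    from (v∉ , σv) with v ∈? W₆ | v ∈? W₀
    ... | yes v∈ | _ = contradiction (∈-++⁺ˡ v∈) v∉
    ... | no _ | yes v∈ = contradiction (∈-++⁺ʳ W₆ v∈) v∉
    ... | no _ | no _ = cong (suc ∘ inject₁) (just-injective (trans (sym (σ≡colour v)) σv))

  size-W₀ : size class (# 0) ≡ 2 * k
  size-W₀ = trans (size≡length class (# 0) W₀-unique class≡0⇔) length-W₀

  size-W₆ : size class (# 6) ≡ k
  size-W₆ = trans (size≡length class (# 6) (AllPairs-DistGt⇒Unique W₆-far) class≡6⇔) length-W₆

  size-colour : ∀ j → s ≤ size class (suc (inject₁ j))
  size-colour j
    with L , length-L , unique , outside , coloured
           ← Seeds-⊑ σ-extends (Seeding.seeded initial (∈-allFin j))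
    = subst (_≤ size class (suc (inject₁ j))) length-L
        (length≤size class _ unique (All.zipWith (Equivalence.from class≡colour⇔) (outside , coloured)))

  colour-independent : ∀ j → KIndep H 2 (λ v → class v ≡ suc (inject₁ j))
  colour-independent j x y cx cy = σ-proper
    (proj₂ (Equivalence.to class≡colour⇔ cx)) (proj₂ (Equivalence.to class≡colour⇔ cy))

  W₆-independent : KIndep H 3 (λ v → class v ≡ # 6)
  W₆-independent x y cx cy = AllPairs-∈ DistGt-sym W₆-far (Equivalence.to class≡6⇔ cx) (Equivalence.to class≡6⇔ cy)

  W₆-degree : ∀ v → class v ≡ # 6 → deg (adj H) v ≡ 2
  W₆-degree v c6 = All.lookup W₆-deg (Equivalence.to class≡6⇔ c6)

  W₀≡N[W₆] : ∀ v → class v ≡ # 0 ⇔ (∃ λ u → class u ≡ # 6 × adj H u v ≡ true)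
  W₀≡N[W₆] v = mk⇔
    (λ c0 → let u , u∈ , uv = Equivalence.to ∈W₀⇔ (Equivalence.to class≡0⇔ c0)
            in u , Equivalence.from class≡6⇔ u∈ , uv)
    (λ (u , c6 , uv) → Equivalence.from class≡0⇔ (Equivalence.from ∈W₀⇔ (u , Equivalence.to class≡6⇔ c6 , uv)))

lemma3p1 : (m : ℕ) → (H : Graph (1000 * m)) → MaximalF2 H →
    Σ (Fin (1000 * m) → Fin 7) λ c →
      (size c (# 0) ≡ 4 * m)
      × (size c (# 6) ≡ 2 * m)
      × (2 * m ≤ size c (# 1)) × (2 * m ≤ size c (# 2)) × (2 * m ≤ size c (# 3))
      × (2 * m ≤ size c (# 4)) × (2 * m ≤ size c (# 5))
      × KIndep H 2 (λ v → c v ≡ # 1) × KIndep H 2 (λ v → c v ≡ # 2)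
      × KIndep H 2 (λ v → c v ≡ # 3) × KIndep H 2 (λ v → c v ≡ # 4)
      × KIndep H 2 (λ v → c v ≡ # 5)
      × KIndep H 3 (λ v → c v ≡ # 6)
      × (∀ v → c v ≡ # 6 → deg (adj H) v ≡ 2)
      × (∀ v → (c v ≡ # 0) ⇔ (∃ λ u → (c u ≡ # 6) × (adj H u v ≡ true)))
lemma3p1 m H maximal =
  class , trans size-W₀ (sym (*-assoc 2 2 m)) , size-W₆ ,
  size-colour (# 0) , size-colour (# 1) , size-colour (# 2) , size-colour (# 3) , size-colour (# 4) ,
  colour-independent (# 0) , colour-independent (# 1) , colour-independent (# 2) ,
  colour-independent (# 3) , colour-independent (# 4) ,
  W₆-independent , W₆-degree , W₀≡N[W₆]
  where
  hub-room : 15 * (2 * m) ≤ 1000 * m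
  hub-room = subst (_≤ 1000 * m) (*-assoc 15 2 m) (*-monoˡ-≤ m (m≤m+n 30 970))
  seed-room : 3 * (2 * m) + 7 * (2 * m * 5) ≤ 1000 * m
  seed-room = subst (_≤ 1000 * m) (sym (collect m)) (*-monoˡ-≤ m (m≤m+n 76 924))
    where
    collect : ∀ n → 3 * (2 * n) + 7 * (2 * n * 5) ≡ 76 * n
    collect = solve-∀
  open Partition H maximal (2 * m) (2 * m) hub-room seed-room
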